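{- For all integers $n\ge 2$, \[ f(10,n)=(n-2)2^{n-1}-\tfrac12(3n-1)(n-2). \]
   Context: For $\pi=\pi_1\cdots\pi_n\in S_n$, its index is the binary string $r^\pi=r_1\cdots r_{n-1}$ with $r_i=0$ if $\pi_i<\pi_{i+1}$ and $r_i=1$ if $\pi_i>\pi_{i+1}$. For a binary string $r$ ending in $0$, $f(r,n)$ is the number of $\pi\in S_n$ whose index is $rr'$ for some binary string $r'$ containing exactly one $1$. -}

module Defs where

open import Data.Bool using (Bool; true; false; _∧_; not; if_then_else_)
open import Data.Nat using (ℕ; zero; suc; _<ᵇ_; _≡ᵇ_)
open import Data.Fin using (Fin; toℕ)
open import Data.List using (List; []; _∷_; length; filter; concatMap; map; allFin)
open import Data.Vec using (Vec; []; _∷_; toList)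
open import Relation.Nullary.Decidable using (does)
open import Data.Bool.Properties using (T?)

-- Binary strings are lists of Bool: false = 0, true = 1.
BinStr : Set
BinStr = List Bool

allVecs : (n k : ℕ) → List (Vec (Fin n) k)
allVecs n zero    = [] ∷ []
allVecs n (suc k) = concatMap (λ i → map (i ∷_) (allVecs n k)) (allFin n)

notElem : ∀ {n} → Fin n → List (Fin n) → Bool
notElem x []       = true
notElem x (y ∷ ys) = not (toℕ x ≡ᵇ toℕ y) ∧ notElem x ys

distinct : ∀ {n} → List (Fin n) → Bool
distinct []       = true
distinct (x ∷ xs) = notElem x xs ∧ distinct xs

-- S_n: permutations π = π_1 ⋯ π_n in one-line notation (injective words of
-- length n over an n-letter alphabet, here Fin n).
Sn : (n : ℕ) → List (Vec (Fin n) n)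
Sn n = filter (λ v → T? (distinct (toList v))) (allVecs n n)

indexL : ∀ {n} → List (Fin n) → BinStr
indexL []            = []
indexL (x ∷ [])      = []
indexL (x ∷ y ∷ xs)  = (toℕ y <ᵇ toℕ x) ∷ indexL (y ∷ xs)

index : ∀ {n} → Vec (Fin n) n → BinStr
index v = indexL (toList v)

ones : BinStr → ℕ
ones []           = 0
ones (true ∷ s)   = suc (ones s)
ones (false ∷ s)  = ones s

-- hasForm r s = true iff s = r r' for some binary string r' with exactly one 1.
hasForm : BinStr → BinStr → Bool
hasForm []      s       = ones s ≡ᵇ 1
hasForm (b ∷ r) []      = false
hasForm (b ∷ r) (c ∷ s) = (if b then c else not c) ∧ hasForm r s

f : BinStr → ℕ → ℕ
f r n = length (filter (λ π → T? (hasForm r (index π))) (Sn n))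

-- A permutation is determined by its first entry r together with the ranks of
-- its later entries among the values not used before them; a step is a descent
-- exactly when the new rank is smaller than the previous one.  So the number of
-- permutations of {0,…,k} starting with r whose index satisfies Q obeys a
-- recursion in k, summing over the rank j < k+1 of the second entry.  For the
-- index patterns met in f(10,n) (no descent, one descent, an ascent followed by
-- one descent, a descent and an ascent followed by one descent) the recursion is
-- solved in closed form by induction on k (powers of 2 up to small corrections),
-- and f(10,n) becomes a geometric plus an arithmetic sum.
module Submission where

open import Defs
open import Algebra.Bundles using (CommutativeMonoid)
open import Data.Bool using (Bool; true; false; _∧_; not; if_then_else_)
open import Data.Bool.ListAction using (all)
open import Data.Bool.Properties
  using (T?; if-cong; if-cong₂; if-cong-else; if-eta; ∧-identityʳ; ∧-commutativeMonoid)
open import Data.Fin using (Fin; toℕ) renaming (zero to fzero; suc to fsuc)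
open import Data.Fin.Properties using (toℕ<n)
open import Data.List
  using (List; []; _∷_; _++_; length; filter; map; concatMap; allFin; tabulate; drop)
open import Data.List.Properties using (filter-++; length-++; map-tabulate)
open import Data.Nat
  using (ℕ; zero; suc; _+_; _*_; _∸_; _^_; _/_; _<_; _≤_; _<ᵇ_; _≡ᵇ_; z≤n; s≤s)
open import Data.Nat.DivMod using (m*n/n≡m; +-distrib-/-∣ˡ)
open import Data.Nat.Divisibility using (divides-refl)
open import Data.Nat.ListAction using (sum)
open import Data.Nat.Properties
open import Data.Nat.Tactic.RingSolver using (solve-∀)
open import Data.Sum using (inj₁; inj₂)
open import Data.Vec using (Vec; toList; _∷_)
open import Function using (_∘_)
open import Relation.Binary.PropositionalEquality
open import Relation.Nullary.Decidable using (yes; no; dec-true; dec-false)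

open import Algebra.Properties.CommutativeSemigroup +-commutativeSemigroup
  using () renaming (interchange to +-interchange)
open import Algebra.Properties.CommutativeSemigroup
  (CommutativeMonoid.commutativeSemigroup ∧-commutativeMonoid)
  using () renaming (interchange to ∧-interchange)

count : {A : Set} → (A → Bool) → List A → ℕ
count P xs = length (filter (λ x → T? (P x)) xs)

count-cong : {A : Set} {P Q : A → Bool} → (∀ x → P x ≡ Q x) → ∀ xs → count P xs ≡ count Q xs
count-cong e [] = refl
count-cong {P = P} {Q} e (x ∷ xs) with P x | Q x | e x
... | true  | .true  | refl = cong suc (count-cong e xs)
... | false | .false | refl = count-cong e xs

count-filter : {A : Set} (P Q : A → Bool) (xs : List A) →
               count Q (filter (λ x → T? (P x)) xs) ≡ count (λ x → P x ∧ Q x) xs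
count-filter P Q [] = refl
count-filter P Q (x ∷ xs) with P x
... | false = count-filter P Q xs
... | true with Q x
...   | true  = cong suc (count-filter P Q xs)
...   | false = count-filter P Q xs

count-∧ : {A : Set} (b : Bool) (P : A → Bool) (xs : List A) →
          count (λ x → b ∧ P x) xs ≡ (if b then count P xs else 0)
count-∧ true  P xs       = refl
count-∧ false P []       = refl
count-∧ false P (x ∷ xs) = count-∧ false P xs

count-map : {A B : Set} (P : B → Bool) (g : A → B) (xs : List A) →
            count P (map g xs) ≡ count (P ∘ g) xs
count-map P g [] = refl
count-map P g (x ∷ xs) with P (g x)
... | true  = cong suc (count-map P g xs)
... | false = count-map P g xs

count-concatMap : {A B : Set} (P : B → Bool) (g : A → List B) (xs : List A) →
                  count P (concatMap g xs) ≡ sum (map (count P ∘ g) xs)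
count-concatMap P g [] = refl
count-concatMap P g (x ∷ xs) = begin
  length (filter P? (g x ++ concatMap g xs))         ≡⟨ cong length (filter-++ P? (g x) _) ⟩
  length (filter P? (g x) ++ filter P? (concatMap g xs)) ≡⟨ length-++ (filter P? (g x)) ⟩
  count P (g x) + count P (concatMap g xs)           ≡⟨ cong (count P (g x) +_) (count-concatMap P g xs) ⟩
  count P (g x) + sum (map (count P ∘ g) xs)         ∎
  where
  open ≡-Reasoning
  P? = λ y → T? (P y)

if-then-cong : {A : Set} (b : Bool) {x y z : A} →
               (b ≡ true → x ≡ y) → (if b then x else z) ≡ (if b then y else z)
if-then-cong true  e = e refl
if-then-cong false e = refl

-- Sums over initial segments of ℕ

sumBelow : (ℕ → ℕ) → ℕ → ℕ
sumBelow g zero    = 0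
sumBelow g (suc n) = sumBelow g n + g n

sumBelow-cong : ∀ {g h : ℕ → ℕ} n → (∀ j → j < n → g j ≡ h j) → sumBelow g n ≡ sumBelow h n
sumBelow-cong zero    e = refl
sumBelow-cong (suc n) e = cong₂ _+_ (sumBelow-cong n (λ j j<n → e j (m<n⇒m<1+n j<n))) (e n ≤-refl)

sumBelow-suc : ∀ (g : ℕ → ℕ) n → sumBelow g (suc n) ≡ g 0 + sumBelow (g ∘ suc) n
sumBelow-suc g zero    = sym (+-identityʳ (g 0))
sumBelow-suc g (suc n) = trans (cong (_+ g (suc n)) (sumBelow-suc g n)) (+-assoc (g 0) _ _)

sumBelow-+ : ∀ (g h : ℕ → ℕ) n → sumBelow g n + sumBelow h n ≡ sumBelow (λ j → g j + h j) n
sumBelow-+ g h zero    = refl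
sumBelow-+ g h (suc n) =
  trans (+-interchange (sumBelow g n) (g n) (sumBelow h n) (h n))
        (cong (_+ (g n + h n)) (sumBelow-+ g h n))

sumBelow-const : ∀ {g : ℕ → ℕ} {c} n → (∀ j → j < n → g j ≡ c) → sumBelow g n ≡ n * c
sumBelow-const zero    e = refl
sumBelow-const {c = c} (suc n) e =
  trans (cong₂ _+_ (sumBelow-const n (λ j j<n → e j (m<n⇒m<1+n j<n))) (e n ≤-refl)) (+-comm (n * c) c)

sum-tabulate : ∀ n (h : Fin n → ℕ) (g : ℕ → ℕ) → (∀ i → h i ≡ g (toℕ i)) →
               sum (tabulate h) ≡ sumBelow g n
sum-tabulate zero    h g e = refl
sum-tabulate (suc n) h g e = begin
  h fzero + sum (tabulate (h ∘ fsuc)) ≡⟨ cong₂ _+_ (e fzero) (sum-tabulate n _ (g ∘ suc) (e ∘ fsuc)) ⟩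
  g 0 + sumBelow (g ∘ suc) n          ≡⟨ sumBelow-suc g n ⟨
  sumBelow g (suc n)                  ∎
  where open ≡-Reasoning

sumBelow-prefix : ∀ (g : ℕ → ℕ) {r} n → r ≤ n →
                  sumBelow (λ j → if j <ᵇ r then g j else 0) n ≡ sumBelow g r
sumBelow-prefix g zero z≤n = refl
sumBelow-prefix g {r} (suc n) r≤1+n with m≤n⇒m<n∨m≡n r≤1+n
... | inj₂ refl  = sumBelow-cong (suc n) (λ j j<r → if-cong (dec-true (j <? r) j<r))
... | inj₁ r<1+n = begin
  sumBelow g<r n + (if n <ᵇ r then g n else 0) ≡⟨ cong (sumBelow g<r n +_) (if-cong n≮r) ⟩
  sumBelow g<r n + 0                           ≡⟨ +-identityʳ _ ⟩
  sumBelow g<r n                               ≡⟨ sumBelow-prefix g n r≤n ⟩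
  sumBelow g r                                 ∎
  where
  open ≡-Reasoning
  g<r = λ j → if j <ᵇ r then g j else 0
  r≤n = ≤-pred r<1+n
  n≮r = dec-false (n <? r) (≤⇒≯ r≤n)

geometric-tail : ∀ k r → 1 + sumBelow (λ j → if j <ᵇ r then 0 else 2 ^ (k ∸ j)) (suc k) ≡ 2 ^ (suc k ∸ r)
geometric-tail zero    zero    = refl
geometric-tail zero    (suc r) = cong (2 ^_) (sym (0∸n≡0 r))
geometric-tail (suc k) zero    = begin
  1 + sumBelow (λ j → 2 ^ (suc k ∸ j)) (suc (suc k))     ≡⟨ cong (1 +_) (sumBelow-suc _ (suc k)) ⟩
  1 + (2 ^ suc k + sumBelow (λ j → 2 ^ (k ∸ j)) (suc k)) ≡⟨ +-suc (2 ^ suc k) _ ⟨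
  2 ^ suc k + (1 + sumBelow (λ j → 2 ^ (k ∸ j)) (suc k)) ≡⟨ cong (2 ^ suc k +_) (geometric-tail k zero) ⟩
  2 ^ suc k + 2 ^ suc k                                  ≡⟨ cong (2 ^ suc k +_) (+-identityʳ _) ⟨
  2 ^ suc (suc k)                                        ∎
  where open ≡-Reasoning
geometric-tail (suc k) (suc r) = trans (cong (1 +_) (sumBelow-suc _ (suc k))) (geometric-tail k r)

arithmetic-series : ∀ c m → 2 * sumBelow (c +_) m + m ≡ m * (2 * c + m)
arithmetic-series c zero    = refl
arithmetic-series c (suc m) = begin
  2 * (sumBelow (c +_) m + (c + m)) + suc m         ≡⟨ regroup (sumBelow (c +_) m) c m ⟩
  (2 * sumBelow (c +_) m + m) + (2 * c + 2 * m + 1) ≡⟨ cong (_+ (2 * c + 2 * m + 1)) (arithmetic-series c m) ⟩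
  m * (2 * c + m) + (2 * c + 2 * m + 1)             ≡⟨ expand c m ⟩
  suc m * (2 * c + suc m)                           ∎
  where
  open ≡-Reasoning
  regroup : ∀ s c m → 2 * (s + (c + m)) + suc m ≡ (2 * s + m) + (2 * c + 2 * m + 1)
  regroup = solve-∀
  expand : ∀ c m → m * (2 * c + m) + (2 * c + 2 * m + 1) ≡ suc m * (2 * c + suc m)
  expand = solve-∀

m+n*2≡o*2⇒n+m/2≡o : ∀ m n o → m + n * 2 ≡ o * 2 → n + m / 2 ≡ o
m+n*2≡o*2⇒n+m/2≡o m n o eq = begin
  n + m / 2         ≡⟨ cong (_+ m / 2) (m*n/n≡m n 2) ⟨
  n * 2 / 2 + m / 2 ≡⟨ +-distrib-/-∣ˡ m (divides-refl n) ⟨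
  (n * 2 + m) / 2   ≡⟨ cong (_/ 2) (trans (+-comm (n * 2) m) eq) ⟩
  o * 2 / 2         ≡⟨ m*n/n≡m o 2 ⟩
  o                 ∎
  where open ≡-Reasoning

-- Ranks among the values satisfying a predicate

countBelow : (ℕ → Bool) → ℕ → ℕ
countBelow p zero    = 0
countBelow p (suc n) = if p n then suc (countBelow p n) else countBelow p n

remove : ℕ → (ℕ → Bool) → ℕ → Bool
remove j p t = p t ∧ not (j ≡ᵇ t)

countBelow-cong : ∀ {p q : ℕ → Bool} n → (∀ t → t < n → p t ≡ q t) → countBelow p n ≡ countBelow q n
countBelow-cong zero    e = refl
countBelow-cong (suc n) e =
  cong₂ (λ b c → if b then suc c else c) (e n ≤-refl) (countBelow-cong n (λ t t<n → e t (m<n⇒m<1+n t<n)))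

countBelow-true : ∀ n → countBelow (λ _ → true) n ≡ n
countBelow-true zero    = refl
countBelow-true (suc n) = cong suc (countBelow-true n)

countBelow-≤-suc : ∀ p n → countBelow p n ≤ countBelow p (suc n)
countBelow-≤-suc p n with p n
... | true  = n≤1+n _
... | false = ≤-refl

countBelow-mono : ∀ p {m n} → m ≤ n → countBelow p m ≤ countBelow p n
countBelow-mono p {n = zero}  z≤n = ≤-refl
countBelow-mono p {n = suc n} m≤1+n with m≤n⇒m<n∨m≡n m≤1+n
... | inj₁ m<1+n = ≤-trans (countBelow-mono p (≤-pred m<1+n)) (countBelow-≤-suc p n)
... | inj₂ refl  = ≤-refl

countBelow-remove-below : ∀ p j → countBelow (remove j p) j ≡ countBelow p j
countBelow-remove-below p j = countBelow-cong j (λ t t<j →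
  trans (cong (λ b → p t ∧ not b) (dec-false (j ≟ t) (>⇒≢ t<j))) (∧-identityʳ (p t)))

countBelow-remove : ∀ p {j} n → p j ≡ true → j < n → suc (countBelow (remove j p) n) ≡ countBelow p n
countBelow-remove p {j} (suc n) pj j<1+n with m≤n⇒m<n∨m≡n (≤-pred j<1+n)
... | inj₂ refl rewrite pj | dec-true (j ≟ j) refl = cong suc (countBelow-remove-below p j)
... | inj₁ j<n rewrite dec-false (j ≟ n) (<⇒≢ j<n) | ∧-identityʳ (p n) with p n
...   | true  = cong suc (countBelow-remove p n pj j<n)
...   | false = countBelow-remove p n pj j<n

<ᵇ-countBelow : ∀ p {j} x → p j ≡ true → (j <ᵇ x) ≡ (countBelow p j <ᵇ countBelow p x)
<ᵇ-countBelow p {j} x pj with j <? x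
... | yes j<x = trans (dec-true (j <? x) j<x) (sym (dec-true (_ <? _) (begin-strict
  countBelow p j       <⟨ n<1+n _ ⟩
  suc (countBelow p j) ≡⟨ if-cong pj ⟨
  countBelow p (suc j) ≤⟨ countBelow-mono p j<x ⟩
  countBelow p x       ∎)))
  where open ≤-Reasoning
... | no  j≮x =
  trans (dec-false (j <? x) j≮x) (sym (dec-false (_ <? _) (≤⇒≯ (countBelow-mono p (≮⇒≥ j≮x)))))

sumBelow-reindex : ∀ p (h : ℕ → ℕ) n →
                   sumBelow (λ t → if p t then h (countBelow p t) else 0) n ≡ sumBelow h (countBelow p n)
sumBelow-reindex p h zero = refl
sumBelow-reindex p h (suc n) with p n
... | true  = cong (_+ h (countBelow p n)) (sumBelow-reindex p h n)
... | false = trans (+-identityʳ _) (sumBelow-reindex p h n)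

-- Counting permutations by the rank of their first entry

-- The number of permutations of {0,…,k} with first entry r whose index satisfies Q.
#startingWith : (BinStr → Bool) → ℕ → ℕ → ℕ
#startingWith Q zero    r = if Q [] then 1 else 0
#startingWith Q (suc k) r = sumBelow (λ j → #startingWith (λ s → Q ((j <ᵇ r) ∷ s)) k j) (suc k)

continuation : ∀ {n} → (BinStr → Bool) → (ℕ → Bool) → Fin n → List (Fin n) → Bool
continuation Q p x w = all (p ∘ toℕ) w ∧ (distinct w ∧ Q (indexL (x ∷ w)))

all-remove : ∀ {n} p (i : Fin n) w → all (remove (toℕ i) p ∘ toℕ) w ≡ all (p ∘ toℕ) w ∧ notElem i w
all-remove p i []      = refl
all-remove p i (y ∷ w) =
  trans (cong (remove (toℕ i) p (toℕ y) ∧_) (all-remove p i w)) (∧-interchange (p (toℕ y)) _ _ _)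

∧-regroup : ∀ a b c d e → (a ∧ b) ∧ ((c ∧ d) ∧ e) ≡ a ∧ ((b ∧ c) ∧ (d ∧ e))
∧-regroup false b     c     d e = refl
∧-regroup true  false c     d e = refl
∧-regroup true  true  false d e = refl
∧-regroup true  true  true  d e = refl

continuation-∷ : ∀ {n} Q p (x i : Fin n) w →
                 continuation Q p x (i ∷ w)
                   ≡ p (toℕ i) ∧ continuation (λ s → Q ((toℕ i <ᵇ toℕ x) ∷ s)) (remove (toℕ i) p) i w
continuation-∷ Q p x i w =
  trans (∧-regroup (p (toℕ i)) (all (p ∘ toℕ) w) (notElem i w) (distinct w) _)
        (cong (λ b → p (toℕ i) ∧ (b ∧ _)) (sym (all-remove p i w)))

count-allVecs-suc : ∀ n k (P : Vec (Fin n) (suc k) → Bool) (g : ℕ → ℕ) →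
                    (∀ i → count (λ v → P (i ∷ v)) (allVecs n k) ≡ g (toℕ i)) →
                    count P (allVecs n (suc k)) ≡ sumBelow g n
count-allVecs-suc n k P g e = begin
  count P (allVecs n (suc k))                 ≡⟨ count-concatMap P _ (allFin n) ⟩
  sum (map (count P ∘ extensions) (allFin n)) ≡⟨ cong sum (map-tabulate {n = n} (λ i → i) _) ⟩
  sum (tabulate (count P ∘ extensions))       ≡⟨ sum-tabulate n _ g by-first-entry ⟩
  sumBelow g n                                ∎
  where
  open ≡-Reasoning
  extensions = λ i → map (i ∷_) (allVecs n k)
  by-first-entry : ∀ i → count P (extensions i) ≡ g (toℕ i)
  by-first-entry i = trans (count-map P (i ∷_) (allVecs n k)) (e i)

-- Ranking the k values allowed by p identifies x followed by a continuation
-- with a permutation of {0,…,k} starting with the rank of x.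
count-continuations : ∀ {n} k Q p (x : Fin n) → countBelow p n ≡ k →
  count (continuation Q p x ∘ toList) (allVecs n k) ≡ #startingWith Q k (countBelow p (toℕ x))
count-continuations zero Q p x e with Q []
... | true  = refl
... | false = refl
count-continuations {n} (suc k) Q p x e = begin
  count (continuation Q p x ∘ toList) (allVecs n (suc k)) ≡⟨ count-allVecs-suc n k _ first first-entry ⟩
  sumBelow first n                                        ≡⟨ sumBelow-reindex p rest n ⟩
  sumBelow rest (countBelow p n)                          ≡⟨ cong (sumBelow rest) e ⟩
  sumBelow rest (suc k)                                   ∎
  where
  open ≡-Reasoning
  rest : ℕ → ℕ
  rest j = #startingWith (λ s → Q ((j <ᵇ countBelow p (toℕ x)) ∷ s)) k j
  first : ℕ → ℕ
  first t = if p t then rest (countBelow p t) else 0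
  first-entry : ∀ i → count (λ v → continuation Q p x (i ∷ toList v)) (allVecs n k) ≡ first (toℕ i)
  first-entry i = begin
    count (λ v → continuation Q p x (i ∷ toList v)) (allVecs n k)
      ≡⟨ count-cong (λ v → continuation-∷ Q p x i (toList v)) (allVecs n k) ⟩
    count (λ v → p (toℕ i) ∧ continuation Q′ p′ i (toList v)) (allVecs n k)
      ≡⟨ count-∧ (p (toℕ i)) _ (allVecs n k) ⟩
    (if p (toℕ i) then count (continuation Q′ p′ i ∘ toList) (allVecs n k) else 0)
      ≡⟨ if-then-cong (p (toℕ i)) recurse ⟩
    first (toℕ i) ∎
    where
    Q′ = λ s → Q ((toℕ i <ᵇ toℕ x) ∷ s)
    p′ = remove (toℕ i) p
    recurse : p (toℕ i) ≡ true →
              count (continuation Q′ p′ i ∘ toList) (allVecs n k) ≡ rest (countBelow p (toℕ i))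
    recurse pᵢ = begin
      count (continuation Q′ p′ i ∘ toList) (allVecs n k)
        ≡⟨ count-continuations k Q′ p′ i (suc-injective (trans (countBelow-remove p n pᵢ (toℕ<n i)) e)) ⟩
      #startingWith Q′ k (countBelow p′ (toℕ i))
        ≡⟨ cong (#startingWith Q′ k) (countBelow-remove-below p (toℕ i)) ⟩
      #startingWith Q′ k (countBelow p (toℕ i))
        ≡⟨ cong (λ b → #startingWith (λ s → Q (b ∷ s)) k (countBelow p (toℕ i)))
                (<ᵇ-countBelow p (toℕ x) pᵢ) ⟩
      rest (countBelow p (toℕ i)) ∎

drop-indexL : ∀ {n} (x : Fin n) w → drop 1 (indexL (x ∷ w)) ≡ indexL w
drop-indexL x []      = refl
drop-indexL x (y ∷ w) = refl

all-true : ∀ {n} (w : List (Fin n)) → all (λ _ → true) w ≡ true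
all-true []      = refl
all-true (y ∷ w) = all-true w

-- Placing any entry, here fzero, in front of a permutation only adds a first
-- index bit, which drop 1 discards.
count-by-index : ∀ m (Q : BinStr → Bool) →
  length (filter (λ π → T? (Q (index π))) (Sn (suc m))) ≡ sumBelow (#startingWith Q m) (suc m)
count-by-index m Q = begin
  count (Q ∘ index) (filter (λ v → T? (distinct (toList v))) (allVecs n n))
    ≡⟨ count-filter _ _ (allVecs n n) ⟩
  count (λ v → distinct (toList v) ∧ Q (index v)) (allVecs n n)
    ≡⟨ count-cong (λ v → sym (as-continuation (toList v))) (allVecs n n) ⟩
  count (continuation (Q ∘ drop 1) (λ _ → true) fzero ∘ toList) (allVecs n n)
    ≡⟨ count-continuations n (Q ∘ drop 1) _ fzero (countBelow-true n) ⟩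
  sumBelow (#startingWith Q m) (suc m) ∎
  where
  open ≡-Reasoning
  n = suc m
  as-continuation : ∀ w → continuation (Q ∘ drop 1) (λ _ → true) fzero w ≡ distinct w ∧ Q (indexL w)
  as-continuation w = cong₂ (λ a s → a ∧ (distinct w ∧ Q s)) (all-true w) (drop-indexL fzero w)

-- The index patterns of f(10,n)

ascending oneDescent ascent-oneDescent descent-ascent-oneDescent : BinStr → Bool
ascending s               = ones s ≡ᵇ 0
oneDescent                = hasForm []
ascent-oneDescent         = hasForm (false ∷ [])
descent-ascent-oneDescent = hasForm (true ∷ false ∷ [])

#startingWith-suc : ∀ Q k r → #startingWith Q (suc k) r
  ≡ sumBelow (λ j → if j <ᵇ r then #startingWith (Q ∘ (true ∷_)) k j
                              else #startingWith (Q ∘ (false ∷_)) k j) (suc k)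
#startingWith-suc Q k r = sumBelow-cong (suc k) (λ j _ → first-step (j <ᵇ r) j)
  where
  first-step : ∀ b j → #startingWith (λ s → Q (b ∷ s)) k j
    ≡ (if b then #startingWith (Q ∘ (true ∷_)) k j else #startingWith (Q ∘ (false ∷_)) k j)
  first-step true  j = refl
  first-step false j = refl

#startingWith-never : ∀ k r → #startingWith (λ _ → false) k r ≡ 0
#startingWith-never zero    r = refl
#startingWith-never (suc k) r =
  trans (sumBelow-const (suc k) (λ j _ → #startingWith-never k j)) (*-zeroʳ (suc k))

ascending-from-suc : ∀ k r → #startingWith ascending (suc k) (suc r) ≡ 0
ascending-from-suc zero    r = refl
ascending-from-suc (suc k) r = begin
  #startingWith ascending (suc (suc k)) (suc r)
    ≡⟨ trans (#startingWith-suc ascending (suc k) (suc r)) (sumBelow-suc _ (suc k)) ⟩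
  N 0 + sumBelow (λ j → if j <ᵇ r then N (suc j) else A (suc j)) (suc k)
    ≡⟨ cong₂ _+_ (#startingWith-never (suc k) 0) (sumBelow-const (suc k) (λ j _ → both-zero j)) ⟩
  suc k * 0
    ≡⟨ *-zeroʳ (suc k) ⟩
  0 ∎
  where
  open ≡-Reasoning
  N = #startingWith (λ _ → false) (suc k)
  A = #startingWith ascending (suc k)
  both-zero : ∀ j → (if j <ᵇ r then N (suc j) else A (suc j)) ≡ 0
  both-zero j =
    trans (if-cong₂ (j <ᵇ r) (#startingWith-never (suc k) (suc j)) (ascending-from-suc k j)) (if-eta (j <ᵇ r))

ascending-from-zero : ∀ k → #startingWith ascending k 0 ≡ 1
ascending-from-zero zero          = refl
ascending-from-zero (suc zero)    = refl
ascending-from-zero (suc (suc k)) = begin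
  #startingWith ascending (suc (suc k)) 0
    ≡⟨ sumBelow-suc _ (suc k) ⟩
  A 0 + sumBelow (A ∘ suc) (suc k)
    ≡⟨ cong₂ _+_ (ascending-from-zero (suc k)) (sumBelow-const (suc k) (λ j _ → ascending-from-suc k j)) ⟩
  1 + suc k * 0
    ≡⟨ cong suc (*-zeroʳ (suc k)) ⟩
  1 ∎
  where
  open ≡-Reasoning
  A = #startingWith ascending (suc k)

oneDescent-from-suc : ∀ k r → #startingWith oneDescent (suc k) (suc r) ≡ 2 ^ (k ∸ r)
oneDescent-from-suc zero    r = cong (2 ^_) (sym (0∸n≡0 r))
oneDescent-from-suc (suc k) r = begin
  #startingWith oneDescent (suc (suc k)) (suc r)
    ≡⟨ trans (#startingWith-suc oneDescent (suc k) (suc r)) (sumBelow-suc _ (suc k)) ⟩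
  A 0 + sumBelow (λ j → if j <ᵇ r then A (suc j) else D (suc j)) (suc k)
    ≡⟨ cong₂ _+_ (ascending-from-zero (suc k)) (sumBelow-cong (suc k) (λ j _ →
         if-cong₂ (j <ᵇ r) (ascending-from-suc k j) (oneDescent-from-suc k j))) ⟩
  1 + sumBelow (λ j → if j <ᵇ r then 0 else 2 ^ (k ∸ j)) (suc k)
    ≡⟨ geometric-tail k r ⟩
  2 ^ (suc k ∸ r) ∎
  where
  open ≡-Reasoning
  A = #startingWith ascending (suc k)
  D = #startingWith oneDescent (suc k)

oneDescent-from-zero : ∀ k → #startingWith oneDescent k 0 + suc k ≡ 2 ^ k
oneDescent-from-zero zero    = refl
oneDescent-from-zero (suc k) = begin
  #startingWith oneDescent (suc k) 0 + suc (suc k) ≡⟨ cong (_+ suc (suc k)) (sumBelow-suc _ k) ⟩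
  (D 0 + later k) + (1 + suc k)                   ≡⟨ regroup (D 0) (later k) (suc k) ⟩
  (D 0 + suc k) + (1 + later k)                   ≡⟨ cong₂ _+_ (oneDescent-from-zero k) (later-total k) ⟩
  2 ^ k + 2 ^ k                                    ≡⟨ cong (2 ^ k +_) (+-identityʳ _) ⟨
  2 ^ suc k                                        ∎
  where
  open ≡-Reasoning
  D = #startingWith oneDescent k
  later : ℕ → ℕ
  later k = sumBelow (λ j → #startingWith oneDescent k (suc j)) k
  later-total : ∀ k → 1 + later k ≡ 2 ^ k
  later-total zero    = refl
  later-total (suc k) =
    trans (cong (1 +_) (sumBelow-cong (suc k) (λ j _ → oneDescent-from-suc k j))) (geometric-tail k 0)
  regroup : ∀ a s m → (a + s) + (1 + m) ≡ (a + m) + (1 + s)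
  regroup = solve-∀

-- Starting from the smallest value, the first step is an ascent.
ascent-oneDescent-from-zero : ∀ k → #startingWith ascent-oneDescent k 0 ≡ #startingWith oneDescent k 0
ascent-oneDescent-from-zero zero    = refl
ascent-oneDescent-from-zero (suc k) = refl

ascent-oneDescent-from-suc : ∀ k r → #startingWith ascent-oneDescent (suc k) (suc r) + 1 ≡ 2 ^ (k ∸ r)
ascent-oneDescent-from-suc zero    r = cong (2 ^_) (sym (0∸n≡0 r))
ascent-oneDescent-from-suc (suc k) r = begin
  #startingWith ascent-oneDescent (suc (suc k)) (suc r) + 1
    ≡⟨ cong (_+ 1) (trans (#startingWith-suc ascent-oneDescent (suc k) (suc r)) (sumBelow-suc _ (suc k))) ⟩
  (N 0 + sumBelow (λ j → if j <ᵇ r then N (suc j) else D (suc j)) (suc k)) + 1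
    ≡⟨ cong (_+ 1) (cong₂ _+_ (#startingWith-never (suc k) 0) (sumBelow-cong (suc k) (λ j _ →
         if-cong₂ (j <ᵇ r) (#startingWith-never (suc k) (suc j)) (oneDescent-from-suc k j)))) ⟩
  sumBelow (λ j → if j <ᵇ r then 0 else 2 ^ (k ∸ j)) (suc k) + 1
    ≡⟨ +-comm _ 1 ⟩
  1 + sumBelow (λ j → if j <ᵇ r then 0 else 2 ^ (k ∸ j)) (suc k)
    ≡⟨ geometric-tail k r ⟩
  2 ^ (suc k ∸ r) ∎
  where
  open ≡-Reasoning
  N = #startingWith (λ _ → false) (suc k)
  D = #startingWith oneDescent (suc k)

descent-ascent-oneDescent-as-prefix : ∀ k r → r ≤ suc k →
  #startingWith descent-ascent-oneDescent (suc k) r ≡ sumBelow (#startingWith ascent-oneDescent k) r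
descent-ascent-oneDescent-as-prefix k r r≤1+k =
  trans (#startingWith-suc descent-ascent-oneDescent k r)
        (trans (sumBelow-cong (suc k) (λ j _ → if-cong-else (j <ᵇ r) (#startingWith-never k j)))
               (sumBelow-prefix _ (suc k) r≤1+k))

ascent-oneDescent-prefixSum : ∀ k r → r ≤ k →
  sumBelow (#startingWith ascent-oneDescent k) (suc r) + (2 ^ (k ∸ r) + (suc k + r)) ≡ 2 ^ suc k
ascent-oneDescent-prefixSum k zero z≤n = begin
  (0 + B 0) + (2 ^ k + (suc k + 0)) ≡⟨ regroup (B 0) (2 ^ k) (suc k) ⟩
  (B 0 + suc k) + (2 ^ k + 0)       ≡⟨ cong (λ a → (a + suc k) + (2 ^ k + 0)) (ascent-oneDescent-from-zero k) ⟩
  (D 0 + suc k) + (2 ^ k + 0)       ≡⟨ cong (_+ (2 ^ k + 0)) (oneDescent-from-zero k) ⟩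
  2 ^ suc k                         ∎
  where
  open ≡-Reasoning
  B = #startingWith ascent-oneDescent k
  D = #startingWith oneDescent k
  regroup : ∀ a p m → (0 + a) + (p + (m + 0)) ≡ (a + m) + (p + 0)
  regroup = solve-∀
ascent-oneDescent-prefixSum (suc k) (suc r) (s≤s r≤k) = begin
  (S + B (suc r)) + (p + (2 + k + suc r))
    ≡⟨ regroup S (B (suc r)) p (2 + k) r ⟩
  S + ((B (suc r) + 1) + (p + 0) + (2 + k + r))
    ≡⟨ cong (λ z → S + (z + (p + 0) + (2 + k + r))) (ascent-oneDescent-from-suc k r) ⟩
  S + (2 ^ suc (k ∸ r) + (2 + k + r))
    ≡⟨ cong (λ e → S + (2 ^ e + (2 + k + r))) (+-∸-assoc 1 r≤k) ⟨
  S + (2 ^ (suc k ∸ r) + (2 + k + r))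
    ≡⟨ ascent-oneDescent-prefixSum (suc k) r (m≤n⇒m≤1+n r≤k) ⟩
  2 ^ suc (suc k) ∎
  where
  open ≡-Reasoning
  B = #startingWith ascent-oneDescent (suc k)
  S = sumBelow B (suc r)
  p = 2 ^ (k ∸ r)
  regroup : ∀ S b p m r → (S + b) + (p + (m + suc r)) ≡ S + ((b + 1) + (p + 0) + (m + r))
  regroup = solve-∀

f[10]-as-prefix-sums : ∀ k → f (true ∷ false ∷ []) (suc (suc k))
                             ≡ sumBelow (λ r → sumBelow (#startingWith ascent-oneDescent k) (suc r)) (suc k)
f[10]-as-prefix-sums k = begin
  f (true ∷ false ∷ []) (suc (suc k))
    ≡⟨ count-by-index (suc k) descent-ascent-oneDescent ⟩
  sumBelow (#startingWith descent-ascent-oneDescent (suc k)) (suc (suc k))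
    ≡⟨ sumBelow-cong (suc (suc k)) (λ r r<2+k → descent-ascent-oneDescent-as-prefix k r (≤-pred r<2+k)) ⟩
  sumBelow (sumBelow (#startingWith ascent-oneDescent k)) (suc (suc k))
    ≡⟨ sumBelow-suc _ (suc k) ⟩
  sumBelow (λ r → sumBelow (#startingWith ascent-oneDescent k) (suc r)) (suc k) ∎
  where open ≡-Reasoning

f[10]-doubled : ∀ k → (3 * k + 5) * k + f (true ∷ false ∷ []) (suc (suc k)) * 2 ≡ k * 2 ^ suc k * 2
f[10]-doubled k =
  eliminate (f (true ∷ false ∷ []) (suc (suc k))) G A (2 ^ suc k)
            sums (geometric-tail k 0) (arithmetic-series (suc k) (suc k))
  where
  G = sumBelow (λ r → 2 ^ (k ∸ r)) (suc k)
  A = sumBelow (suc k +_) (suc k)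
  S = λ r → sumBelow (#startingWith ascent-oneDescent k) (suc r)
  sums : f (true ∷ false ∷ []) (suc (suc k)) + (G + A) ≡ suc k * 2 ^ suc k
  sums = begin
    f (true ∷ false ∷ []) (suc (suc k)) + (G + A)
      ≡⟨ cong₂ _+_ (f[10]-as-prefix-sums k) (sumBelow-+ _ _ (suc k)) ⟩
    sumBelow S (suc k) + sumBelow (λ r → 2 ^ (k ∸ r) + (suc k + r)) (suc k)
      ≡⟨ sumBelow-+ S _ (suc k) ⟩
    sumBelow (λ r → S r + (2 ^ (k ∸ r) + (suc k + r))) (suc k)
      ≡⟨ sumBelow-const (suc k) (λ r r<1+k → ascent-oneDescent-prefixSum k r (≤-pred r<1+k)) ⟩
    suc k * 2 ^ suc k ∎
    where open ≡-Reasoning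
  eliminate : ∀ F G A W → F + (G + A) ≡ suc k * W → 1 + G ≡ W →
              2 * A + suc k ≡ suc k * (2 * suc k + suc k) → (3 * k + 5) * k + F * 2 ≡ k * W * 2
  eliminate F G A W sums geometric arithmetic = +-cancelʳ-≡ (2 * (1 + G) + (2 * A + suc k)) _ _ (begin
    (3 * k + 5) * k + F * 2 + (2 * (1 + G) + (2 * A + suc k))
      ≡⟨ e₁ F G A k ⟩
    (3 * k + 5) * k + k + 3 + 2 * (F + (G + A))
      ≡⟨ cong (λ z → (3 * k + 5) * k + k + 3 + 2 * z) sums ⟩
    (3 * k + 5) * k + k + 3 + 2 * (suc k * W)
      ≡⟨ e₂ k W ⟩
    k * W * 2 + (2 * W + suc k * (2 * suc k + suc k))
      ≡⟨ cong₂ (λ u v → k * W * 2 + (2 * u + v)) geometric arithmetic ⟨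
    k * W * 2 + (2 * (1 + G) + (2 * A + suc k)) ∎)
    where
    open ≡-Reasoning
    e₁ : ∀ F G A k → (3 * k + 5) * k + F * 2 + (2 * (1 + G) + (2 * A + suc k))
                       ≡ (3 * k + 5) * k + k + 3 + 2 * (F + (G + A))
    e₁ = solve-∀
    e₂ : ∀ k W → (3 * k + 5) * k + k + 3 + 2 * (suc k * W)
                   ≡ k * W * 2 + (2 * W + suc k * (2 * suc k + suc k))
    e₂ = solve-∀

lemma4p2 : (n : ℕ) → 2 ≤ n →
    f (true ∷ false ∷ []) n + ((3 * n ∸ 1) * (n ∸ 2)) / 2 ≡ (n ∸ 2) * 2 ^ (n ∸ 1)
lemma4p2 (suc (suc k)) (s≤s (s≤s z≤n)) = begin
  f (true ∷ false ∷ []) (suc (suc k)) + ((3 * suc (suc k) ∸ 1) * k) / 2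
    ≡⟨ cong (λ c → f (true ∷ false ∷ []) (suc (suc k)) + ((c ∸ 1) * k) / 2) (three-times k) ⟩
  f (true ∷ false ∷ []) (suc (suc k)) + ((3 * k + 5) * k) / 2
    ≡⟨ m+n*2≡o*2⇒n+m/2≡o ((3 * k + 5) * k) _ (k * 2 ^ suc k) (f[10]-doubled k) ⟩
  k * 2 ^ suc k ∎
  where
  open ≡-Reasoning
  three-times : ∀ k → 3 * suc (suc k) ≡ suc (3 * k + 5)
  three-times = solve-∀
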